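{- For any finite simple undirected graph $G$, $\text{2- }\eta_{P+I}(G)\leq \mathrm{v}(G)-\beta(G)-\mathrm{c}(G)$.
   Context: $P(G)$ is the parity Laplacian of $G$: the $\mathbb{F}_2$-matrix obtained by reducing $L(G)=D(G)-A(G)$ modulo $2$ (diagonal entries are degrees mod 2, off-diagonal entries are adjacency entries); $I$ is the identity matrix; $\text{2- }\eta_{P+I}(G)$ is the dimension of the kernel of $P(G)+I$ over $\mathbb{F}_2$. $\mathrm{v}(G)$ and $\mathrm{c}(G)$ are the numbers of vertices and connected components. The edge space is the $\mathbb{F}_2$-vector space of subsets of $E(G)$ under symmetric difference; the cycle space consists of edge sets in which every vertex has even degree; the cut space consists of the edge sets $\{uv\in E(G): u\in S, v\notin S\}$, $S\subseteq V(G)$; the bicycle space is their intersection and $\beta(G)$ is its dimension. -}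

module Defs where

open import Data.Nat using (ℕ; zero; suc)
open import Data.Fin using (Fin; zero; suc; _≟_)
open import Data.Bool using (Bool; true; false; _∧_; _xor_; not; if_then_else_)
open import Data.Product using (Σ; _×_; _,_; ∃)
open import Function using (Surjective)
open import Relation.Nullary using (¬_; Dec; yes; no)
open import Relation.Nullary.Decidable using (⌊_⌋)
open import Relation.Binary.PropositionalEquality using (_≡_)

record Graph (n : ℕ) : Set where
  field
    adj     : Fin n → Fin n → Bool
    symm    : ∀ u v → adj u v ≡ adj v u
    irrefl  : ∀ u → adj u u ≡ false
open Graph public

⊕-sum : ∀ {n} → (Fin n → Bool) → Bool
⊕-sum {zero}  f = false
⊕-sum {suc n} f = f zero xor ⊕-sum (λ i → f (suc i))

_≐_ : ∀ {X : Set} → (X → Bool) → (X → Bool) → Set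
f ≐ g = ∀ x → f x ≡ g x

lincomb : ∀ {X : Set} {d : ℕ} → (Fin d → Bool) → (Fin d → X → Bool) → X → Bool
lincomb c w x = ⊕-sum (λ i → c i ∧ w i x)

HasDim : ∀ {X : Set} → ((X → Bool) → Set) → ℕ → Set
HasDim {X} W d =
  Σ (Fin d → X → Bool) λ w →
    (∀ i → W (w i)) ×
    (∀ (c : Fin d → Bool) → lincomb c w ≐ (λ _ → false) → ∀ i → c i ≡ false) ×
    (∀ f → W f → Σ (Fin d → Bool) λ c → f ≐ lincomb c w)

module _ {n : ℕ} (G : Graph n) where

  degParity : Fin n → Bool
  degParity u = ⊕-sum (λ v → adj G u v)

  -- P(G) = L(G) mod 2
  P : Fin n → Fin n → Bool
  P u v = if ⌊ u ≟ v ⌋ then degParity u else adj G u v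

  P+I : Fin n → Fin n → Bool
  P+I u v = P u v xor ⌊ u ≟ v ⌋

  KerP+I : (Fin n → Bool) → Set
  KerP+I x = ∀ u → ⊕-sum (λ v → P+I u v ∧ x v) ≡ false

  -- Edge space: subsets F ⊆ E(G), encoded as symmetric functions
  -- F : Fin n × Fin n → Bool supported on edges (F(u,v) = F(v,u) = "uv ∈ F").

  IsEdgeSet : (Fin n × Fin n → Bool) → Set
  IsEdgeSet F = (∀ u v → F (u , v) ≡ F (v , u))
              × (∀ u v → F (u , v) ≡ true → adj G u v ≡ true)

  InCycleSpace : (Fin n × Fin n → Bool) → Set
  InCycleSpace F = IsEdgeSet F × (∀ u → ⊕-sum (λ v → F (u , v)) ≡ false)

  InCutSpace : (Fin n × Fin n → Bool) → Set
  InCutSpace F = Σ (Fin n → Bool) λ S →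
    ∀ u v → F (u , v) ≡ (adj G u v ∧ (S u xor S v))

  InBicycleSpace : (Fin n × Fin n → Bool) → Set
  InBicycleSpace F = InCycleSpace F × InCutSpace F

  data Reach : Fin n → Fin n → Set where
    here : ∀ {u} → Reach u u
    step : ∀ {u v w} → adj G u v ≡ true → Reach v w → Reach u w

  HasComponents : ℕ → Set
  HasComponents c = Σ (Fin n → Fin c) λ comp →
    (∀ y → Σ (Fin n) λ u → comp u ≡ y) ×
    (∀ u v → (comp u ≡ comp v → Reach u v) × (Reach u v → comp u ≡ comp v))

-- A basis of ker(P+I), the shores of a basis of the bicycle space and the indicator
-- vectors of the components together form a linearly independent family in F₂^V, so
-- η + β + c ≤ n. The value of P x at u is the parity of the number of edges of the cut
-- of x at u; hence shores (a bicycle is an even cut) and component indicators (whose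
-- cuts are empty) lie in ker P, which meets ker(P+I) only in 0. If a combination of
-- shores equals a combination of indicators, it is constant on components, so the
-- corresponding combination of bicycles -- its cut -- is empty and all its
-- coefficients vanish.
module Submission where

open import Defs
open import Algebra.Bundles using (CommutativeMonoid; CommutativeRing)
open import Data.Bool using (Bool; true; false; _∧_; _xor_; if_then_else_)
open import Data.Bool.Properties
  using (xor-∧-commutativeRing; ∧-commutativeMonoid; xor-assoc; xor-same; xor-identityʳ;
         ∧-comm; ∧-zeroʳ; ∧-distribˡ-xor; ∧-distribʳ-xor)
open import Algebra.Properties.Semiring.Sum (CommutativeRing.semiring xor-∧-commutativeRing)
  using (sum; sum-cong-≗; sum-replicate-zero; ∑-distrib-+; ∑-comm; *-distribˡ-sum; *-distribʳ-sum)
open import Algebra.Properties.CommutativeSemigroup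
  (CommutativeMonoid.commutativeSemigroup ∧-commutativeMonoid) using (x∙yz≈y∙xz)
open import Data.Fin using (Fin; zero; suc; _≟_; _↑ˡ_; _↑ʳ_; splitAt; funToFin; finToFun; combine)
open import Data.Fin.Properties
  using (2↔Bool; splitAt-↑ˡ; splitAt-↑ʳ; splitAt⁻¹-↑ˡ; splitAt⁻¹-↑ʳ;
         funToFin-finToFin; finToFun-funToFin; injective⇒≤)
open import Data.Nat using (ℕ; zero; suc; _+_; _≤_; _^_; s≤s; z≤n)
open import Data.Nat.Properties using (+-assoc; ≮⇒≥; <⇒≱; ^-monoʳ-<)
open import Data.Product using (Σ; _×_; _,_; proj₂)
open import Data.Sum using (inj₁; inj₂; [_,_]′)
open import Data.Vec.Functional using (_++_)
open import Data.Vec.Functional.Relation.Unary.All.Properties using (++⁺)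
open import Function using (_∘_; Inverse)
open import Relation.Nullary.Decidable using (Dec; ⌊_⌋; ⌊⌋-map′; yes; no)
open import Relation.Binary.PropositionalEquality
  using (_≡_; refl; sym; trans; cong; cong₂; subst; module ≡-Reasoning)
open ≡-Reasoning

⊕-sum≡sum : ∀ {n} (f : Fin n → Bool) → ⊕-sum f ≡ sum f
⊕-sum≡sum {zero}  f = refl
⊕-sum≡sum {suc n} f = cong (f zero xor_) (⊕-sum≡sum (f ∘ suc))

⊕-sum-cong : ∀ {n} {f g : Fin n → Bool} → f ≐ g → ⊕-sum f ≡ ⊕-sum g
⊕-sum-cong {f = f} {g} f≐g rewrite ⊕-sum≡sum f | ⊕-sum≡sum g = sum-cong-≗ f≐g

⊕-sum-zero : ∀ {n} {f : Fin n → Bool} → (∀ i → f i ≡ false) → ⊕-sum f ≡ false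
⊕-sum-zero {n} {f} f≐0 rewrite ⊕-sum≡sum f = trans (sum-cong-≗ f≐0) (sum-replicate-zero n)

⊕-sum-xor : ∀ {n} (f g : Fin n → Bool) → ⊕-sum (λ i → f i xor g i) ≡ ⊕-sum f xor ⊕-sum g
⊕-sum-xor f g rewrite ⊕-sum≡sum f | ⊕-sum≡sum g | ⊕-sum≡sum (λ i → f i xor g i) = ∑-distrib-+ f g

∧-distribˡ-⊕-sum : ∀ {n} a (f : Fin n → Bool) → a ∧ ⊕-sum f ≡ ⊕-sum (λ i → a ∧ f i)
∧-distribˡ-⊕-sum a f rewrite ⊕-sum≡sum f | ⊕-sum≡sum (λ i → a ∧ f i) = *-distribˡ-sum a f

∧-distribʳ-⊕-sum : ∀ {n} a (f : Fin n → Bool) → ⊕-sum f ∧ a ≡ ⊕-sum (λ i → f i ∧ a)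
∧-distribʳ-⊕-sum a f rewrite ⊕-sum≡sum f | ⊕-sum≡sum (λ i → f i ∧ a) = *-distribʳ-sum a f

⊕-sum-comm : ∀ {m n} (f : Fin m → Fin n → Bool) →
             ⊕-sum (λ i → ⊕-sum (f i)) ≡ ⊕-sum (λ j → ⊕-sum (λ i → f i j))
⊕-sum-comm f = begin
  ⊕-sum (λ i → ⊕-sum (f i))            ≡⟨ ⊕-sum≡sum (λ i → ⊕-sum (f i)) ⟩
  sum (λ i → ⊕-sum (f i))              ≡⟨ sum-cong-≗ (λ i → ⊕-sum≡sum (f i)) ⟩
  sum (λ i → sum (f i))                ≡⟨ ∑-comm f ⟩
  sum (λ j → sum (λ i → f i j))        ≡⟨ sum-cong-≗ (λ j → ⊕-sum≡sum (λ i → f i j)) ⟨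
  sum (λ j → ⊕-sum (λ i → f i j))      ≡⟨ ⊕-sum≡sum (λ j → ⊕-sum (λ i → f i j)) ⟨
  ⊕-sum (λ j → ⊕-sum (λ i → f i j))    ∎

⊕-sum-δ : ∀ {n} (u : Fin n) (g : Fin n → Bool) → ⊕-sum (λ v → ⌊ u ≟ v ⌋ ∧ g v) ≡ g u
⊕-sum-δ {suc n} zero    g = trans (cong (g zero xor_) (⊕-sum-zero {n} (λ _ → refl))) (xor-identityʳ (g zero))
⊕-sum-δ {suc n} (suc u) g =
  trans (⊕-sum-cong (λ v → cong (_∧ g (suc v)) (⌊⌋-map′ _ _ (u ≟ v)))) (⊕-sum-δ u (g ∘ suc))

⊕-sum-↑ : ∀ {m n} (f : Fin (m + n) → Bool) →
          ⊕-sum f ≡ ⊕-sum (f ∘ (_↑ˡ n)) xor ⊕-sum (f ∘ (m ↑ʳ_))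
⊕-sum-↑ {zero}  f = refl
⊕-sum-↑ {suc m} {n} f = trans (cong (f zero xor_) (⊕-sum-↑ {m} {n} (f ∘ suc))) (sym (xor-assoc (f zero) _ _))

0ᵥ : {X : Set} → X → Bool
0ᵥ _ = false

LinearIndependent : {X : Set} {d : ℕ} → (Fin d → X → Bool) → Set
LinearIndependent w = ∀ c → lincomb c w ≐ 0ᵥ → ∀ i → c i ≡ false

xor≡false⇒≡ : ∀ a b → a xor b ≡ false → a ≡ b
xor≡false⇒≡ false false _ = refl
xor≡false⇒≡ true  true  _ = refl

↑-elim : ∀ {p q} (P : Fin (p + q) → Set) → (∀ i → P (i ↑ˡ q)) → (∀ j → P (p ↑ʳ j)) → ∀ k → P k
↑-elim {p} P left right k with splitAt p k in split
... | inj₁ i = subst P (splitAt⁻¹-↑ˡ split) (left i)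
... | inj₂ j = subst P (splitAt⁻¹-↑ʳ split) (right j)

module _ {X : Set} where

  lincomb-xorᶜ : ∀ {d} (a b : Fin d → Bool) (w : Fin d → X → Bool) x →
                 lincomb (λ i → a i xor b i) w x ≡ lincomb a w x xor lincomb b w x
  lincomb-xorᶜ a b w x =
    trans (⊕-sum-cong (λ i → ∧-distribʳ-xor (w i x) (a i) (b i)))
          (⊕-sum-xor (λ i → a i ∧ w i x) (λ i → b i ∧ w i x))

  lincomb-zeroᶜ : ∀ {d} {c : Fin d → Bool} (w : Fin d → X → Bool) →
                  (∀ i → c i ≡ false) → lincomb c w ≐ 0ᵥ
  lincomb-zeroᶜ w c≐0 x = ⊕-sum-zero (λ i → cong (_∧ w i x) (c≐0 i))

  lincomb-injective : ∀ {d} {w : Fin d → X → Bool} → LinearIndependent w →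
                      ∀ {a b} → lincomb a w ≐ lincomb b w → ∀ i → a i ≡ b i
  lincomb-injective {w = w} w-indep {a} {b} same i =
    xor≡false⇒≡ (a i) (b i) (w-indep (λ i → a i xor b i) difference i)
    where
    difference : lincomb (λ i → a i xor b i) w ≐ 0ᵥ
    difference x = begin
      lincomb (λ i → a i xor b i) w x        ≡⟨ lincomb-xorᶜ a b w x ⟩
      lincomb a w x xor lincomb b w x        ≡⟨ cong (_xor lincomb b w x) (same x) ⟩
      lincomb b w x xor lincomb b w x        ≡⟨ xor-same (lincomb b w x) ⟩
      false                                  ∎

  lincomb-++ : ∀ {p q} (e : Fin (p + q) → Bool) (f : Fin p → X → Bool) (g : Fin q → X → Bool) x →
               lincomb e (f ++ g) x ≡ lincomb (e ∘ (_↑ˡ q)) f x xor lincomb (e ∘ (p ↑ʳ_)) g x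
  lincomb-++ {p} {q} e f g x = trans (⊕-sum-↑ {p} {q} _) (cong₂ _xor_
    (⊕-sum-cong (λ i → cong (λ s → e (i ↑ˡ q) ∧ [ f , g ]′ s x) (splitAt-↑ˡ p i q)))
    (⊕-sum-cong (λ j → cong (λ s → e (p ↑ʳ j) ∧ [ f , g ]′ s x) (splitAt-↑ʳ p q j))))

  ++-independent : ∀ {p q} {f : Fin p → X → Bool} {g : Fin q → X → Bool} →
                   LinearIndependent f → LinearIndependent g →
                   (∀ a b → lincomb a f ≐ lincomb b g → lincomb a f ≐ 0ᵥ) →
                   LinearIndependent (f ++ g)
  ++-independent {p} {q} {f} {g} f-indep g-indep disjoint e e≐0 =
    ↑-elim (λ k → e k ≡ false) a≐0 b≐0
    where
    a : Fin p → Bool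
    a = e ∘ (_↑ˡ q)
    b : Fin q → Bool
    b = e ∘ (p ↑ʳ_)
    same : lincomb a f ≐ lincomb b g
    same x = xor≡false⇒≡ _ _ (trans (sym (lincomb-++ e f g x)) (e≐0 x))
    a≐0 : ∀ i → a i ≡ false
    a≐0 = f-indep a (disjoint a b same)
    b≐0 : ∀ j → b j ≡ false
    b≐0 = g-indep b (λ x → trans (sym (same x)) (disjoint a b same x))

funToFin-cong : ∀ {m n} {f g : Fin m → Fin n} → (∀ i → f i ≡ g i) → funToFin f ≡ funToFin g
funToFin-cong {zero}  f≐g = refl
funToFin-cong {suc m} f≐g = cong₂ combine (f≐g zero) (funToFin-cong (f≐g ∘ suc))

module _ {k : ℕ} where
  open Inverse 2↔Bool using (to; from; strictlyInverseˡ; strictlyInverseʳ)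

  encode : (Fin k → Bool) → Fin (2 ^ k)
  encode f = funToFin (from ∘ f)

  decode : Fin (2 ^ k) → Fin k → Bool
  decode i = to ∘ finToFun i

  encode-cong : ∀ {f g} → f ≐ g → encode f ≡ encode g
  encode-cong f≐g = funToFin-cong (cong from ∘ f≐g)

  decode-encode : ∀ f → decode (encode f) ≐ f
  decode-encode f u = trans (cong to (finToFun-funToFin (from ∘ f) u)) (strictlyInverseˡ (f u))

  encode-decode : ∀ i → encode (decode i) ≡ i
  encode-decode i = trans (funToFin-cong {k} (strictlyInverseʳ ∘ finToFun i)) (funToFin-finToFin {k} i)

  encode-injective : ∀ {f g} → encode f ≡ encode g → f ≐ g
  encode-injective {f} {g} eq u =
    trans (sym (decode-encode f u)) (trans (cong (λ i → decode i u) eq) (decode-encode g u))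

-- c ↦ Σ c_i w_i embeds F₂^d into F₂^n, so 2^d ≤ 2^n.
independent⇒≤ : ∀ {d n} {w : Fin d → Fin n → Bool} → LinearIndependent w → d ≤ n
independent⇒≤ {d} {n} {w} w-indep =
  ≮⇒≥ (λ n<d → <⇒≱ (^-monoʳ-< 2 (s≤s (s≤s z≤n)) n<d) (injective⇒≤ coordinates-injective))
  where
  coordinates : Fin (2 ^ d) → Fin (2 ^ n)
  coordinates i = encode (lincomb (decode i) w)

  coordinates-injective : ∀ {i j} → coordinates i ≡ coordinates j → i ≡ j
  coordinates-injective {i} {j} eq = begin
    i                        ≡⟨ encode-decode {d} i ⟨
    encode (decode {d} i)    ≡⟨ encode-cong (lincomb-injective w-indep (encode-injective eq)) ⟩
    encode (decode {d} j)    ≡⟨ encode-decode {d} j ⟩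
    j                        ∎

infixr 25 _·_

_·_ : ∀ {n} → (Fin n → Fin n → Bool) → (Fin n → Bool) → Fin n → Bool
(M · x) u = ⊕-sum (λ v → M u v ∧ x v)

_+I : ∀ {n} → (Fin n → Fin n → Bool) → Fin n → Fin n → Bool
(M +I) u v = M u v xor ⌊ u ≟ v ⌋

module _ {n : ℕ} (M : Fin n → Fin n → Bool) where

  ·-cong : ∀ {x y} → x ≐ y → M · x ≐ M · y
  ·-cong x≐y u = ⊕-sum-cong (λ v → cong (M u v ∧_) (x≐y v))

  ·-lincomb : ∀ {d} (a : Fin d → Bool) (w : Fin d → Fin n → Bool) →
              M · lincomb a w ≐ lincomb a (λ i → M · w i)
  ·-lincomb a w u = begin
    ⊕-sum (λ v → M u v ∧ ⊕-sum (λ i → a i ∧ w i v))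
      ≡⟨ ⊕-sum-cong (λ v → ∧-distribˡ-⊕-sum (M u v) (λ i → a i ∧ w i v)) ⟩
    ⊕-sum (λ v → ⊕-sum (λ i → M u v ∧ (a i ∧ w i v)))
      ≡⟨ ⊕-sum-comm (λ v i → M u v ∧ (a i ∧ w i v)) ⟩
    ⊕-sum (λ i → ⊕-sum (λ v → M u v ∧ (a i ∧ w i v)))
      ≡⟨ ⊕-sum-cong (λ i → ⊕-sum-cong (λ v → x∙yz≈y∙xz (M u v) (a i) (w i v))) ⟩
    ⊕-sum (λ i → ⊕-sum (λ v → a i ∧ (M u v ∧ w i v)))
      ≡⟨ ⊕-sum-cong (λ i → ∧-distribˡ-⊕-sum (a i) (λ v → M u v ∧ w i v)) ⟨
    ⊕-sum (λ i → a i ∧ (M · w i) u)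
      ∎

  kernel-lincomb : ∀ {d} (a : Fin d → Bool) {w : Fin d → Fin n → Bool} →
                   (∀ i → M · w i ≐ 0ᵥ) → M · lincomb a w ≐ 0ᵥ
  kernel-lincomb a {w} w≐0 u = trans (·-lincomb a w u)
    (⊕-sum-zero (λ i → trans (cong (a i ∧_) (w≐0 i u)) (∧-zeroʳ (a i))))

  ·-+I : ∀ x u → ((M +I) · x) u ≡ (M · x) u xor x u
  ·-+I x u = begin
    ⊕-sum (λ v → (M u v xor ⌊ u ≟ v ⌋) ∧ x v)
      ≡⟨ ⊕-sum-cong (λ v → ∧-distribʳ-xor (x v) (M u v) ⌊ u ≟ v ⌋) ⟩
    ⊕-sum (λ v → (M u v ∧ x v) xor (⌊ u ≟ v ⌋ ∧ x v))
      ≡⟨ ⊕-sum-xor (λ v → M u v ∧ x v) (λ v → ⌊ u ≟ v ⌋ ∧ x v) ⟩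
    (M · x) u xor ⊕-sum (λ v → ⌊ u ≟ v ⌋ ∧ x v)
      ≡⟨ cong ((M · x) u xor_) (⊕-sum-δ u x) ⟩
    (M · x) u xor x u
      ∎

  kernel∩kernel-+I : ∀ {x} → M · x ≐ 0ᵥ → (M +I) · x ≐ 0ᵥ → x ≐ 0ᵥ
  kernel∩kernel-+I {x} Mx≐0 M+Ix≐0 u = begin
    x u                  ≡⟨ cong (_xor x u) (Mx≐0 u) ⟨
    (M · x) u xor x u    ≡⟨ ·-+I x u ⟨
    ((M +I) · x) u       ≡⟨ M+Ix≐0 u ⟩
    false                ∎

module _ {n c : ℕ} (comp : Fin n → Fin c) where

  indicator : Fin c → Fin n → Bool
  indicator k u = ⌊ comp u ≟ k ⌋

  lincomb-indicator : ∀ d u → lincomb d indicator u ≡ d (comp u)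
  lincomb-indicator d u = trans (⊕-sum-cong (λ k → ∧-comm (d k) (indicator k u))) (⊕-sum-δ (comp u) d)

  indicators-independent : (∀ k → Σ (Fin n) λ u → comp u ≡ k) → LinearIndependent indicator
  indicators-independent onto d χd≐0 k with onto k
  ... | u , refl = trans (sym (lincomb-indicator d u)) (χd≐0 u)

module _ {n : ℕ} (G : Graph n) where

  cut : (Fin n → Bool) → Fin n × Fin n → Bool
  cut S (u , v) = adj G u v ∧ (S u xor S v)

  EdgeConstant : {A : Set} → (Fin n → A) → Set
  EdgeConstant S = ∀ u v → adj G u v ≡ true → S u ≡ S v

  edge-constant⇒cut≐0 : ∀ {S} → EdgeConstant S → cut S ≐ 0ᵥ
  edge-constant⇒cut≐0 {S} S-const (u , v) with adj G u v in uv
  ... | false = refl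
  ... | true rewrite S-const u v uv = xor-same (S v)

  lincomb-cut : ∀ {d} (b : Fin d → Bool) (S : Fin d → Fin n → Bool) →
                lincomb b (cut ∘ S) ≐ cut (lincomb b S)
  lincomb-cut b S (u , v) = begin
    ⊕-sum (λ j → b j ∧ (adj G u v ∧ (S j u xor S j v)))
      ≡⟨ ⊕-sum-cong (λ j → x∙yz≈y∙xz (b j) (adj G u v) (S j u xor S j v)) ⟩
    ⊕-sum (λ j → adj G u v ∧ (b j ∧ (S j u xor S j v)))
      ≡⟨ ∧-distribˡ-⊕-sum (adj G u v) (λ j → b j ∧ (S j u xor S j v)) ⟨
    adj G u v ∧ ⊕-sum (λ j → b j ∧ (S j u xor S j v))
      ≡⟨ cong (adj G u v ∧_) (⊕-sum-cong (λ j → ∧-distribˡ-xor (b j) (S j u) (S j v))) ⟩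
    adj G u v ∧ ⊕-sum (λ j → (b j ∧ S j u) xor (b j ∧ S j v))
      ≡⟨ cong (adj G u v ∧_) (⊕-sum-xor (λ j → b j ∧ S j u) (λ j → b j ∧ S j v)) ⟩
    adj G u v ∧ (lincomb b S u xor lincomb b S v)
      ∎

  P-entry : ∀ (x : Fin n → Bool) u v (u≟v : Dec (u ≡ v)) →
            (if ⌊ u≟v ⌋ then degParity G u else adj G u v) ∧ x v
              ≡ (⌊ u≟v ⌋ ∧ (degParity G u ∧ x u)) xor (adj G u v ∧ x v)
  P-entry x u .u (yes refl) rewrite irrefl G u = sym (xor-identityʳ _)
  P-entry x u v  (no _)     = refl

  P·≡cut-degree : ∀ x u → (P G · x) u ≡ ⊕-sum (λ v → cut x (u , v))
  P·≡cut-degree x u = begin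
    ⊕-sum (λ v → P G u v ∧ x v)
      ≡⟨ ⊕-sum-cong (λ v → P-entry x u v (u ≟ v)) ⟩
    ⊕-sum (λ v → (⌊ u ≟ v ⌋ ∧ (degParity G u ∧ x u)) xor (adj G u v ∧ x v))
      ≡⟨ ⊕-sum-xor (λ v → ⌊ u ≟ v ⌋ ∧ (degParity G u ∧ x u)) (λ v → adj G u v ∧ x v) ⟩
    ⊕-sum (λ v → ⌊ u ≟ v ⌋ ∧ (degParity G u ∧ x u)) xor ⊕-sum (λ v → adj G u v ∧ x v)
      ≡⟨ cong (_xor ⊕-sum (λ v → adj G u v ∧ x v)) (⊕-sum-δ u (λ _ → degParity G u ∧ x u)) ⟩
    (degParity G u ∧ x u) xor ⊕-sum (λ v → adj G u v ∧ x v)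
      ≡⟨ cong (_xor ⊕-sum (λ v → adj G u v ∧ x v)) (∧-distribʳ-⊕-sum (x u) (adj G u)) ⟩
    ⊕-sum (λ v → adj G u v ∧ x u) xor ⊕-sum (λ v → adj G u v ∧ x v)
      ≡⟨ ⊕-sum-xor (λ v → adj G u v ∧ x u) (λ v → adj G u v ∧ x v) ⟨
    ⊕-sum (λ v → (adj G u v ∧ x u) xor (adj G u v ∧ x v))
      ≡⟨ ⊕-sum-cong (λ v → ∧-distribˡ-xor (adj G u v) (x u) (x v)) ⟨
    ⊕-sum (λ v → cut x (u , v))
      ∎

  edge-constant⇒P-kernel : ∀ {S} → EdgeConstant S → P G · S ≐ 0ᵥ
  edge-constant⇒P-kernel S-const u =
    trans (P·≡cut-degree _ u) (⊕-sum-zero (λ v → edge-constant⇒cut≐0 S-const (u , v)))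

  shore : ∀ {F} → InBicycleSpace G F → Fin n → Bool
  shore (_ , S , _) = S

  shore-in-P-kernel : ∀ {F} (F∈B : InBicycleSpace G F) → P G · shore F∈B ≐ 0ᵥ
  shore-in-P-kernel ((_ , F-even) , S , F≐cut) u =
    trans (P·≡cut-degree S u) (trans (⊕-sum-cong (λ v → sym (F≐cut u v))) (F-even u))

  module _ {β} {F : Fin β → Fin n × Fin n → Bool}
           (F∈B : ∀ j → InBicycleSpace G (F j)) (F-indep : LinearIndependent F) where

    shores : Fin β → Fin n → Bool
    shores j = shore (F∈B j)

    empty-cut⇒trivial : ∀ b → cut (lincomb b shores) ≐ 0ᵥ → ∀ j → b j ≡ false
    empty-cut⇒trivial b cut≐0 = F-indep b λ where
      (u , v) → begin
        lincomb b F (u , v)                ≡⟨ ⊕-sum-cong (λ j → cong (b j ∧_) (proj₂ (proj₂ (F∈B j)) u v)) ⟩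
        lincomb b (cut ∘ shores) (u , v)   ≡⟨ lincomb-cut b shores (u , v) ⟩
        cut (lincomb b shores) (u , v)     ≡⟨ cut≐0 (u , v) ⟩
        false                              ∎

    shores-independent : LinearIndependent shores
    shores-independent b Sb≐0 =
      empty-cut⇒trivial b (edge-constant⇒cut≐0 (λ u v _ → trans (Sb≐0 u) (sym (Sb≐0 v))))

    shores∩indicators : ∀ {c} {comp : Fin n → Fin c} → EdgeConstant comp →
                        ∀ b d → lincomb b shores ≐ lincomb d (indicator comp) →
                        lincomb b shores ≐ 0ᵥ
    shores∩indicators {comp = comp} comp-const b d same =
      lincomb-zeroᶜ shores (empty-cut⇒trivial b (edge-constant⇒cut≐0 Sb-const))
      where
      Sb-const : EdgeConstant (lincomb b shores)
      Sb-const u v uv = begin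
        lincomb b shores u                 ≡⟨ same u ⟩
        lincomb d (indicator comp) u       ≡⟨ lincomb-indicator comp d u ⟩
        d (comp u)                         ≡⟨ cong d (comp-const u v uv) ⟩
        d (comp v)                         ≡⟨ lincomb-indicator comp d v ⟨
        lincomb d (indicator comp) v       ≡⟨ same v ⟨
        lincomb b shores v                 ∎

theorem10 : ∀ (n : ℕ) (G : Graph n) (η β c : ℕ) →
    HasDim (KerP+I G) η →
    HasDim (InBicycleSpace G) β →
    HasComponents G c →
    η + β + c ≤ n
theorem10 n G η β c (w , w∈ker , w-indep , _) (F , F∈B , F-indep , _) (comp , comp-onto , comp-reach) =
  subst (_≤ n) (sym (+-assoc η β c)) (independent⇒≤ (++-independent w-indep S++χ-indep w∩S++χ))
  where
  S : Fin β → Fin n → Bool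
  S = shores G F∈B F-indep
  χ : Fin c → Fin n → Bool
  χ = indicator comp

  comp-const : EdgeConstant G comp
  comp-const u v uv = proj₂ (comp-reach u v) (step uv here)

  S++χ-indep : LinearIndependent (S ++ χ)
  S++χ-indep = ++-independent (shores-independent G F∈B F-indep) (indicators-independent comp comp-onto)
                              (shores∩indicators G F∈B F-indep comp-const)

  S++χ-in-P-kernel : ∀ k → P G · (S ++ χ) k ≐ 0ᵥ
  S++χ-in-P-kernel = ++⁺ (λ x → P G · x ≐ 0ᵥ) (shore-in-P-kernel G ∘ F∈B)
                         (λ k → edge-constant⇒P-kernel G (λ u v uv → cong (λ t → ⌊ t ≟ k ⌋) (comp-const u v uv)))

  w∩S++χ : ∀ a e → lincomb a w ≐ lincomb e (S ++ χ) → lincomb a w ≐ 0ᵥ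
  w∩S++χ a e same = kernel∩kernel-+I (P G)
    (λ u → trans (·-cong (P G) same u) (kernel-lincomb (P G) e S++χ-in-P-kernel u))
    (kernel-lincomb (P G +I) a w∈ker)
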